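{- Let $G$ be a nontrivial connected graph with $\lambda^+(G)=\Delta(G)$. Then $\mathrm{rd}(G)\leq \lambda^+(G)+1$.
   Context: $\lambda(u,v)$ is the minimum number of edges whose removal puts $u$ and $v$ in different components; $\lambda^+(G)=\max\{\lambda(u,v):u,v\in V(G)\}$ (upper edge-connectivity). Given an edge-coloring (adjacent edges may share colors), a rainbow-cut is an edge-cut with pairwise distinct colors; $G$ is rainbow disconnected if every two distinct vertices are separated by some rainbow-cut. $\mathrm{rd}(G)$ is the minimum number of colors of an edge-coloring making $G$ rainbow disconnected. -}

module Defs where

open import Data.Nat using (ℕ; zero; suc; _+_; _⊔_; _≤_)
open import Data.Bool using (Bool; true; false; if_then_else_)
open import Data.Fin using (Fin; _<_)
open import Data.List using (List; []; _∷_; map; length; foldr; allFin)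
open import Data.Nat.ListAction using (sum)
open import Data.List.Membership.Propositional using (_∈_)
open import Data.List.Relation.Unary.All using (All)
open import Data.List.Relation.Unary.Unique.Propositional using (Unique)
open import Data.Product using (Σ; ∃; ∃-syntax; _×_; _,_; proj₁; proj₂)
open import Data.Sum using (_⊎_)
open import Relation.Binary.PropositionalEquality using (_≡_)
open import Relation.Nullary using (¬_)

record Graph (n : ℕ) : Set where
  field
    adj   : Fin n → Fin n → Bool
    sym   : ∀ i j → adj i j ≡ adj j i
    irrefl : ∀ i → adj i i ≡ false
open Graph public

-- An edge {i,j} is represented canonically by the ordered pair (i , j) with i < j.
IsEdge : ∀ {n} → Graph n → Fin n × Fin n → Set
IsEdge G (i , j) = (i < j) × (adj G i j ≡ true)

record EdgeSet {n : ℕ} (G : Graph n) : Set where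
  constructor edgeSet
  field
    edges   : List (Fin n × Fin n)
    allEdge : All (IsEdge G) edges
    unique  : Unique edges
open EdgeSet public

size : ∀ {n} {G : Graph n} → EdgeSet G → ℕ
size F = length (edges F)

Removed : ∀ {n} → List (Fin n × Fin n) → Fin n → Fin n → Set
Removed F a b = ((a , b) ∈ F) ⊎ ((b , a) ∈ F)

data Reach {n : ℕ} (G : Graph n) (F : List (Fin n × Fin n)) : Fin n → Fin n → Set where
  here : ∀ {u} → Reach G F u u
  step : ∀ {u w v} → adj G u w ≡ true → ¬ Removed F u w → Reach G F w v → Reach G F u v

Connected : ∀ {n} → Graph n → Set
Connected G = ∀ u v → Reach G [] u v

Separates : ∀ {n} {G : Graph n} → EdgeSet G → Fin n → Fin n → Set
Separates {G = G} F u v = ¬ Reach G (edges F) u v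

IsLocalEdgeConn : ∀ {n} → Graph n → Fin n → Fin n → ℕ → Set
IsLocalEdgeConn G u v m =
  (Σ (EdgeSet G) λ F → Separates F u v × size F ≡ m) ×
  (∀ (F : EdgeSet G) → Separates F u v → m ≤ size F)

IsUpperEdgeConn : ∀ {n} → Graph n → ℕ → Set
IsUpperEdgeConn {n} G L =
  (Σ (Fin n × Fin n) λ p → ¬ proj₁ p ≡ proj₂ p × IsLocalEdgeConn G (proj₁ p) (proj₂ p) L) ×
  (∀ (u v : Fin n) (m : ℕ) → ¬ u ≡ v → IsLocalEdgeConn G u v m → m ≤ L)

degree : ∀ {n} → Graph n → Fin n → ℕ
degree {n} G i = sum (map (λ j → if adj G i j then 1 else 0) (allFin n))

maxDegree : ∀ {n} → Graph n → ℕ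
maxDegree {n} G = foldr _⊔_ 0 (map (degree G) (allFin n))

-- Edge-colouring with colours from Fin k (only values on canonical edge pairs matter).
Colouring : ∀ {n} → Graph n → ℕ → Set
Colouring {n} G k = Fin n → Fin n → Fin k

Rainbow : ∀ {n k} {G : Graph n} → Colouring G k → EdgeSet G → Set
Rainbow c F = Unique (map (λ e → c (proj₁ e) (proj₂ e)) (edges F))

RainbowDisconnecting : ∀ {n k} (G : Graph n) → Colouring G k → Set
RainbowDisconnecting {n} G c =
  ∀ (u v : Fin n) → ¬ u ≡ v → Σ (EdgeSet G) λ F → Rainbow c F × Separates F u v

RdAtMost : ∀ {n} → Graph n → ℕ → Set
RdAtMost G k = Σ (Colouring G k) λ c → RainbowDisconnecting G c

-- Under a proper edge colouring the edges at a vertex u have pairwise distinct colours, and deleting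
-- them cuts u off from every other vertex; so a proper edge colouring is rainbow disconnecting and
-- rd(G) ≤ χ'(G). Vizing's theorem χ'(G) ≤ Δ(G) + 1 and λ⁺(G) = Δ(G) give the bound.
--
-- Vizing's theorem is proved by colouring the edges one at a time with Δ + 1 colours, so that every
-- vertex always misses a colour. To colour a new edge x y₀, grow a fan y₀, y₁, … at x in which x yₗ₊₁
-- has the colour missing at yₗ. If some colour is missing both at x and at the last spoke, rotating
-- the fan (giving each x yₗ the colour of x yₗ₊₁) frees a colour for x y₀. Otherwise the fan closes
-- up on itself; then swapping α (missing at x) and β (missing at the last spoke) off the α/β Kempe
-- chain starting at x makes α missing at some spoke as well, and the fan up to that spoke is rotated.

module Submission where

open import Data.Bool using (Bool; true; false; _∧_; _∨_; if_then_else_)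
import Data.Bool.Properties as Bool
open import Data.Empty using (⊥; ⊥-elim)
open import Data.Fin using (Fin; toℕ; _≟_)
import Data.Fin.Permutation.Components as PC
import Data.Fin.Properties as Fin
open import Data.List using (List; []; _∷_; map; length; filter; foldr; allFin; cartesianProduct)
open import Data.List.Membership.Propositional using (_∈_)
open import Data.List.Membership.Propositional.Properties
  using (∈-allFin; ∈-cartesianProduct⁺; ∈-filter⁺; ∈-filter⁻; ∈-map⁺; ∈-map⁻)
import Data.List.Membership.Setoid.Properties as SetoidMembership
open import Data.List.Properties using (map-cong; map-∘)
import Data.List.Relation.Unary.All as All
import Data.List.Relation.Unary.All.Properties as AllP
open import Data.List.Relation.Unary.AllPairs using ([]; _∷_)
open import Data.List.Relation.Unary.Any as Any using (Any; here; there)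
open import Data.List.Relation.Unary.Unique.Propositional using (Unique)
import Data.List.Relation.Unary.Unique.Propositional.Properties as UniqueP
open import Data.Maybe using (Maybe; just; nothing; _>>=_)
open import Data.Maybe.Properties using (just-injective) renaming (≡-dec to maybe-≡-dec)
open import Data.Nat using (ℕ; zero; suc; _+_; _⊔_; _≤_; _<_; z≤n; s≤s) renaming (_≟_ to _≟ℕ_)
open import Data.Nat.ListAction using (sum)
import Data.Nat.Properties as ℕ
open import Data.Product using (Σ; ∃; ∃-syntax; _×_; _,_; proj₁; proj₂)
open import Data.Sum as Sum using (_⊎_; inj₁; inj₂; [_,_]; [_,_]′)
open import Function using (_∘_; const)
open import Function.Bundles using (mk⇔)
open import Function.Definitions using (Injective)
open import Relation.Binary using (tri<; tri≈; tri>)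
open import Relation.Binary.PropositionalEquality hiding ([_])
open import Relation.Nullary using (¬_; ¬?; Dec; yes; no; does; contradiction)
open import Relation.Nullary.Decidable using (_×-dec_; _⊎-dec_; dec-true; dec-false; does-⇔)

open import Defs renaming (sym to adj-sym)

distinct-prefix⇒< : ∀ {n t} (f : ∀ i → i ≤ t → Fin n) →
                    (∀ {a b} (a≤t : a ≤ t) (b≤t : b ≤ t) → a < b → f a a≤t ≢ f b b≤t) → t < n
distinct-prefix⇒< {n} {t} f distinct with t ℕ.<? n
... | yes t<n = t<n
... | no t≮n =
  let i , j , i<j , same = Fin.pigeonhole ℕ.≤-refl (λ i → f (toℕ i) (bounded i))
  in ⊥-elim (distinct (bounded i) (bounded j) i<j same)
  where
  bounded : (i : Fin (suc n)) → toℕ i ≤ t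
  bounded i = ℕ.≤-trans (Fin.toℕ≤pred[n] i) (ℕ.≮⇒≥ t≮n)

sum-indicator≡length-filter : ∀ {A : Set} (b : A → Bool) xs →
  sum (map (λ j → if b j then 1 else 0) xs) ≡ length (filter (λ j → b j Bool.≟ true) xs)
sum-indicator≡length-filter b [] = refl
sum-indicator≡length-filter b (x ∷ xs) with b x
... | true = cong suc (sum-indicator≡length-filter b xs)
... | false = sum-indicator≡length-filter b xs

∈⇒≤-foldr-⊔ : ∀ {x} xs → x ∈ xs → x ≤ foldr _⊔_ 0 xs
∈⇒≤-foldr-⊔ (y ∷ ys) (here refl) = ℕ.m≤m⊔n y _
∈⇒≤-foldr-⊔ (y ∷ ys) (there x∈ys) = ℕ.≤-trans (∈⇒≤-foldr-⊔ ys x∈ys) (ℕ.m≤n⊔m y _)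

unique-map⁺-∈ : ∀ {A B : Set} {f : A → B} {xs : List A} →
              (∀ {a b} → a ∈ xs → b ∈ xs → f a ≡ f b → a ≡ b) → Unique xs → Unique (map f xs)
unique-map⁺-∈ {xs = []} _ [] = []
unique-map⁺-∈ {f = f} {x ∷ xs} f-injective (x∉xs ∷ unique) =
  All.tabulate differs ∷ unique-map⁺-∈ (λ a∈ b∈ → f-injective (there a∈) (there b∈)) unique
  where
  differs : ∀ {z} → z ∈ map f xs → f x ≢ z
  differs z∈ eq with ∈-map⁻ f z∈
  ... | w , w∈xs , refl = All.lookup x∉xs w∈xs (f-injective (here refl) (there w∈xs) eq)

-- Edge colourings

Edge : ∀ {n} → Graph n → Fin n → Fin n → Set
Edge G a b = adj G a b ≡ true

edge-sym : ∀ {n} (G : Graph n) {a b} → Edge G a b → Edge G b a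
edge-sym G {a} {b} e = trans (adj-sym G b a) e

edge-irrefl : ∀ {n} (G : Graph n) {a} → ¬ Edge G a a
edge-irrefl G {a} e with trans (sym (irrefl G a)) e
... | ()

module _ {n : ℕ} (G : Graph n) where

  adjacent? : ∀ v j → Dec (Edge G v j)
  adjacent? v j = adj G v j Bool.≟ true

  neighbours : Fin n → List (Fin n)
  neighbours v = filter (adjacent? v) (allFin n)

  ∈-neighbours⁺ : ∀ {v j} → Edge G v j → j ∈ neighbours v
  ∈-neighbours⁺ {v} {j} = ∈-filter⁺ (adjacent? v) (∈-allFin j)

  ∈-neighbours⁻ : ∀ {v j} → j ∈ neighbours v → Edge G v j
  ∈-neighbours⁻ {v} = proj₂ ∘ ∈-filter⁻ (adjacent? v) {xs = allFin n}

  neighbours-unique : ∀ v → Unique (neighbours v)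
  neighbours-unique v = UniqueP.filter⁺ (adjacent? v) (UniqueP.allFin⁺ n)

EdgeColouring : ℕ → ℕ → Set
EdgeColouring n k = Fin n → Fin n → Fin k

module _ {n k : ℕ} where

  Symmetric : EdgeColouring n k → Set
  Symmetric c = ∀ a b → c a b ≡ c b a

  Proper : Graph n → EdgeColouring n k → Set
  Proper G c = ∀ v {w w'} → Edge G v w → Edge G v w' → c v w ≡ c v w' → w ≡ w'

  Meets : Graph n → EdgeColouring n k → Fin n → Fin k → Set
  Meets G c v δ = ∃[ w ] Edge G v w × c v w ≡ δ

  Misses : Graph n → EdgeColouring n k → Fin n → Fin k → Set
  Misses G c v δ = ∀ w → Edge G v w → c v w ≢ δ

  meets-or-misses : ∀ G c v δ → Meets G c v δ ⊎ Misses G c v δ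
  meets-or-misses G c v δ with Fin.any? (λ w → adjacent? G v w ×-dec (c v w ≟ δ))
  ... | yes met = inj₁ met
  ... | no ¬met = inj₂ λ w e q → ¬met (w , e , q)

  misses? : ∀ G c v δ → Dec (Misses G c v δ)
  misses? G c v δ with meets-or-misses G c v δ
  ... | inj₁ (w , e , q) = no λ m → m w e q
  ... | inj₂ m = yes m

ProperEdgeColouring : ∀ {n} → Graph n → ℕ → Set
ProperEdgeColouring {n} G k = Σ (EdgeColouring n k) λ c → Symmetric c × Proper G c

_⊆_ : ∀ {n} → Graph n → Graph n → Set
H ⊆ G = ∀ {a b} → Edge H a b → Edge G a b

proper-⊆ : ∀ {n k} {H G : Graph n} {c : EdgeColouring n k} → H ⊆ G → Proper G c → Proper H c
proper-⊆ H⊆G c-proper v e e' = c-proper v (H⊆G e) (H⊆G e')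

DegreeAtMost : ∀ {n} → Graph n → ℕ → Set
DegreeAtMost {n} G Δ =
  ∀ v (g : Fin (suc Δ) → Fin n) → (∀ i → Edge G v (g i)) → ¬ Injective _≡_ _≡_ g

degreeAtMost-⊆ : ∀ {n Δ} {H G : Graph n} → H ⊆ G → DegreeAtMost G Δ → DegreeAtMost H Δ
degreeAtMost-⊆ H⊆G bound v g edges = bound v g (H⊆G ∘ edges)

misses-some-colour : ∀ {n Δ} {G : Graph n} {c : EdgeColouring n (suc Δ)} →
                     DegreeAtMost G Δ → Proper G c → ∀ v → ∃ (Misses G c v)
misses-some-colour {G = G} {c} bound c-proper v with Fin.any? (misses? G c v)
... | yes found = found
... | no none = ⊥-elim (bound v (proj₁ ∘ met) (proj₁ ∘ proj₂ ∘ met) injective)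
  where
  met : ∀ δ → Meets G c v δ
  met δ = [ (λ m → m) , (λ m → contradiction (δ , m) none) ]′ (meets-or-misses G c v δ)
  injective : Injective _≡_ _≡_ (proj₁ ∘ met)
  injective {δ} {δ'} eq = begin
    δ                     ≡⟨ proj₂ (proj₂ (met δ)) ⟨
    c v (proj₁ (met δ))   ≡⟨ cong (c v) eq ⟩
    c v (proj₁ (met δ'))  ≡⟨ proj₂ (proj₂ (met δ')) ⟩
    δ'                    ∎
    where open ≡-Reasoning

-- Kempe chains

module KempePath {n k : ℕ} (G : Graph n) (c : EdgeColouring n k) (c-sym : Symmetric c)
  (c-proper : Proper G c) {α β : Fin k} (α≢β : α ≢ β) (x : Fin n) (x-misses-α : Misses G c x α)
  where

  stepColour : ℕ → Fin k
  stepColour zero = β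
  stepColour (suc zero) = α
  stepColour (suc (suc t)) = stepColour t

  stepColour-α⇒suc-β : ∀ {t} → stepColour t ≡ α → stepColour (suc t) ≡ β
  stepColour-α⇒suc-β {zero} β≡α = contradiction (sym β≡α) α≢β
  stepColour-α⇒suc-β {suc zero} _ = refl
  stepColour-α⇒suc-β {suc (suc t)} = stepColour-α⇒suc-β {t}

  stepColour-cover : ∀ t {δ} → δ ≡ α ⊎ δ ≡ β → δ ≡ stepColour t ⊎ δ ≡ stepColour (suc t)
  stepColour-cover zero = Sum.swap
  stepColour-cover (suc zero) αβ = αβ
  stepColour-cover (suc (suc t)) = stepColour-cover t

  stepColour-αβ : ∀ t → stepColour t ≡ α ⊎ stepColour t ≡ β
  stepColour-αβ zero = inj₂ refl
  stepColour-αβ (suc zero) = inj₁ refl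
  stepColour-αβ (suc (suc t)) = stepColour-αβ t

  next : ℕ → Fin n → Maybe (Fin n)
  next t v = [ just ∘ proj₁ , const nothing ] (meets-or-misses G c v (stepColour t))

  walk : ℕ → Maybe (Fin n)
  walk zero = just x
  walk (suc t) = walk t >>= next t

  walk-pred : ∀ t {w} → walk (suc t) ≡ just w →
              ∃[ v ] walk t ≡ just v × Edge G v w × c v w ≡ stepColour t
  walk-pred t eq with walk t
  ... | just v with meets-or-misses G c v (stepColour t) | eq
  ...   | inj₁ (w , e , q) | refl = v , refl , e , q

  walk-step : ∀ t {v w} → walk t ≡ just v → Edge G v w → c v w ≡ stepColour t →
              walk (suc t) ≡ just w
  walk-step t {v} {w} eq e q rewrite eq with meets-or-misses G c v (stepColour t)
  ... | inj₁ (w' , e' , q') = cong just (c-proper v e' e (trans q' (sym q)))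
  ... | inj₂ m = contradiction q (m w e)

  walk-stop : ∀ t {v} → walk t ≡ just v → Misses G c v (stepColour t) → walk (suc t) ≡ nothing
  walk-stop t {v} eq m rewrite eq with meets-or-misses G c v (stepColour t)
  ... | inj₁ (w , e , q) = contradiction q (m w e)
  ... | inj₂ _ = refl

  walk-prefix : ∀ {a b v} → a ≤ b → walk b ≡ just v → ∃[ u ] walk a ≡ just u
  walk-prefix {b = zero} z≤n eq = _ , eq
  walk-prefix {a} {suc b} a≤b eq with ℕ.m≤n⇒m<n∨m≡n a≤b
  ... | inj₂ refl = _ , eq
  ... | inj₁ (s≤s a≤b') = walk-prefix a≤b' (proj₁ (proj₂ (walk-pred b eq)))

  mutual
    -- The path leaves x along its β-edge, so coming back needs a second β-edge at x.
    walk-never-returns : ∀ b → walk (suc b) ≢ just x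
    walk-never-returns b eq with walk-pred b eq
    ... | q , walk-b , qx , cqx = returns b walk-b cqx
      where
      xq = edge-sym G qx
      cxq-β : ∀ {t} → c q x ≡ stepColour t → c x q ≡ β
      cxq-β {t} cqx with stepColour-αβ t
      ... | inj₁ α = contradiction (trans (c-sym x q) (trans cqx α)) (x-misses-α q xq)
      ... | inj₂ β = trans (c-sym x q) (trans cqx β)
      returns : ∀ t → walk t ≡ just q → c q x ≡ stepColour t → ⊥
      returns zero refl _ = edge-irrefl G qx
      returns (suc zero) _ cqx = α≢β (trans (sym cqx) (trans (c-sym q x) (cxq-β {1} cqx)))
      returns (suc (suc t)) walk-t cqx =
        walk-injective {1} {suc (suc t)} (s≤s (s≤s z≤n))
          (walk-step 0 refl xq (cxq-β {suc (suc t)} cqx)) walk-t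

    walk-injective : ∀ {a b v} → a < b → walk a ≡ just v → walk b ≡ just v → ⊥
    walk-injective {zero} {suc b} _ refl walk-b = walk-never-returns b walk-b
    walk-injective {suc a} {suc b} {v} (s≤s a<b) walk-a walk-b
      with walk-pred a walk-a | walk-pred b walk-b
    ... | r , walk-r , rv , crv | q , walk-q , qv , cqv with stepColour a ≟ stepColour b
    ... | yes same = walk-injective a<b walk-r (subst (λ z → walk b ≡ just z) (sym r≡q) walk-q)
      where
      r≡q : r ≡ q
      r≡q = c-proper v (edge-sym G rv) (edge-sym G qv)
              (trans (c-sym v r) (trans crv (trans same (trans (sym cqv) (c-sym q v)))))
    ... | no differ = beyond (ℕ.m≤n⇒m<n∨m≡n a<b)
      where
      cvq : c v q ≡ stepColour (suc a)
      cvq with stepColour-cover a (stepColour-αβ b)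
      ... | inj₁ eq = contradiction (sym eq) differ
      ... | inj₂ eq = trans (c-sym v q) (trans cqv eq)
      walk-ssa : walk (suc (suc a)) ≡ just q
      walk-ssa = walk-step (suc a) walk-a (edge-sym G qv) cvq
      beyond : suc a < b ⊎ suc a ≡ b → ⊥
      beyond (inj₂ refl) =
        edge-irrefl G (subst (λ z → Edge G z v) (just-injective (trans (sym walk-q) walk-a)) qv)
      beyond (inj₁ sa<b) with ℕ.m≤n⇒m<n∨m≡n sa<b
      ... | inj₁ ssa<b = walk-injective ssa<b walk-ssa walk-q
      ... | inj₂ refl = differ refl

  walk-length : ∀ {t v} → walk t ≡ just v → t < n
  walk-length walk-t = distinct-prefix⇒< (λ i i≤t → proj₁ (walk-prefix i≤t walk-t))
    λ {a} {b} a≤t b≤t a<b same → walk-injective a<b (proj₂ (walk-prefix a≤t walk-t))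
      (subst (λ z → walk b ≡ just z) (sym same) (proj₂ (walk-prefix b≤t walk-t)))

  OnPath : Fin n → Set
  OnPath w = ∃[ t ] walk t ≡ just w

  onPath? : ∀ w → Dec (OnPath w)
  onPath? w with ℕ.anyUpTo? (λ t → maybe-≡-dec _≟_ (walk t) (just w)) n
  ... | yes (t , _ , walk-t) = yes (t , walk-t)
  ... | no ¬found = no λ (t , walk-t) → ¬found (t , walk-length walk-t , walk-t)

  onPath-closed : ∀ {v w} → OnPath v → Edge G v w → c v w ≡ α ⊎ c v w ≡ β → OnPath w
  onPath-closed (zero , refl) e (inj₁ α) = contradiction α (x-misses-α _ e)
  onPath-closed (zero , refl) e (inj₂ β) = 1 , walk-step 0 refl e β
  onPath-closed {v} {w} (suc t , walk-v) e αβ with walk-pred t walk-v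
  ... | r , walk-r , rv , crv with stepColour-cover t αβ
  ... | inj₁ eq = t , subst (λ z → walk t ≡ just z) (sym w≡r) walk-r
    where
    w≡r = c-proper v e (edge-sym G rv) (trans eq (trans (sym crv) (c-sym r v)))
  ... | inj₂ eq = suc (suc t) , walk-step (suc t) walk-v e eq

  walk-end : ∀ t {u} → walk t ≡ just u → u ≢ x → Misses G c u β → walk (suc t) ≡ nothing
  walk-end zero refl u≢x _ = contradiction refl u≢x
  walk-end (suc t) {u} walk-u _ u-misses-β with walk-pred t walk-u
  ... | r , _ , ru , cru =
    walk-stop (suc t) walk-u (subst (Misses G c u) (sym (stepColour-α⇒suc-β {t} α-step)) u-misses-β)
    where
    α-step : stepColour t ≡ α
    α-step with stepColour-αβ t
    ... | inj₁ eq = eq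
    ... | inj₂ eq = contradiction (trans (c-sym u r) (trans cru eq)) (u-misses-β r (edge-sym G ru))

  onPath-end-unique : ∀ {u u'} → OnPath u → OnPath u' → u ≢ x → u' ≢ x →
                      Misses G c u β → Misses G c u' β → u ≡ u'
  onPath-end-unique (a , walk-u) (b , walk-u') u≢x u'≢x mu mu' with ℕ.<-cmp a b
  ... | tri≈ _ refl _ = just-injective (trans (sym walk-u) walk-u')
  ... | tri< a<b _ _ with walk-prefix a<b walk-u'
  ...   | _ , defined with trans (sym (walk-end a walk-u u≢x mu)) defined
  ...     | ()
  onPath-end-unique (a , walk-u) (b , walk-u') u≢x u'≢x mu mu' | tri> _ _ b<a with walk-prefix b<a walk-u
  ...   | _ , defined with trans (sym (walk-end b walk-u' u'≢x mu')) defined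
  ...     | ()

module _ {k : ℕ} where

  transpose-injective : ∀ (i j : Fin k) {a b} → PC.transpose i j a ≡ PC.transpose i j b → a ≡ b
  transpose-injective i j eq =
    trans (sym (PC.transpose-inverse j i)) (trans (cong (PC.transpose j i) eq) (PC.transpose-inverse j i))

  transpose-ʳ : ∀ (i j : Fin k) → PC.transpose i j j ≡ i
  transpose-ʳ i j with j ≟ i
  ... | yes refl = refl
  ... | no _ rewrite dec-true (j ≟ j) refl = refl

  transpose-fix : ∀ (i j : Fin k) {a} → a ≢ i → a ≢ j → PC.transpose i j a ≡ a
  transpose-fix i j {a} a≢i a≢j rewrite dec-false (a ≟ i) a≢i | dec-false (a ≟ j) a≢j = refl

module KempeSwap {n k : ℕ} (G : Graph n) (c : EdgeColouring n k) (c-sym : Symmetric c)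
  (c-proper : Proper G c) (α β : Fin k) (S : Fin n → Set) (S? : ∀ v → Dec (S v))
  (S-closed : ∀ {v u} → S v → Edge G v u → c v u ≡ α ⊎ c v u ≡ β → S u)
  where

  swapIf : Bool → Fin k → Fin k
  swapIf true = PC.transpose α β
  swapIf false δ = δ

  swapIf-injective : ∀ b {δ δ'} → swapIf b δ ≡ swapIf b δ' → δ ≡ δ'
  swapIf-injective true = transpose-injective α β
  swapIf-injective false eq = eq

  swapIf-fix : ∀ b {δ} → δ ≢ α → δ ≢ β → swapIf b δ ≡ δ
  swapIf-fix true = transpose-fix α β
  swapIf-fix false _ _ = refl

  swapped : EdgeColouring n k
  swapped a b = swapIf (does (S? a) ∧ does (S? b)) (c a b)

  swapped-sym : Symmetric swapped
  swapped-sym a b rewrite Bool.∧-comm (does (S? a)) (does (S? b)) | c-sym a b = refl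

  αβ-edge-within : ∀ {v u} → Edge G v u → c v u ≡ α ⊎ c v u ≡ β → does (S? u) ≡ does (S? v)
  αβ-edge-within {v} {u} e αβ with S? v | S? u
  ... | yes _ | yes _ = refl
  ... | no _ | no _ = refl
  ... | yes sv | no ¬su = contradiction (S-closed sv e αβ) ¬su
  ... | no ¬sv | yes su = contradiction (S-closed su (edge-sym G e) (Sum.map flip flip αβ)) ¬sv
    where
    flip : ∀ {δ} → c v u ≡ δ → c u v ≡ δ
    flip = trans (c-sym u v)

  swapped-edge : ∀ {v u} → Edge G v u → swapped v u ≡ swapIf (does (S? v)) (c v u)
  swapped-edge {v} {u} e with c v u ≟ α | c v u ≟ β
  ... | yes cα | _ rewrite αβ-edge-within e (inj₁ cα) | Bool.∧-idem (does (S? v)) = refl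
  ... | no _ | yes cβ rewrite αβ-edge-within e (inj₂ cβ) | Bool.∧-idem (does (S? v)) = refl
  ... | no ¬α | no ¬β =
    trans (swapIf-fix (does (S? v) ∧ does (S? u)) ¬α ¬β) (sym (swapIf-fix (does (S? v)) ¬α ¬β))

  swapped-edge-cancel : ∀ {v u δ} → Edge G v u → swapped v u ≡ swapIf (does (S? v)) δ → c v u ≡ δ
  swapped-edge-cancel {v} e q = swapIf-injective (does (S? v)) (trans (sym (swapped-edge e)) q)

  swapped-proper : Proper G swapped
  swapped-proper v e e' q = c-proper v e e' (swapped-edge-cancel e (trans q (swapped-edge e')))

  swapped-misses-α : ∀ {s} → S s → Misses G c s β → Misses G swapped s α
  swapped-misses-α {s} in-S misses-β u e q = misses-β u e (swapped-edge-cancel e (trans q (sym swaps-β)))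
    where
    swaps-β : swapIf (does (S? s)) β ≡ α
    swaps-β rewrite dec-true (S? s) in-S = transpose-ʳ α β

  swapped-misses : ∀ {v δ} → δ ≢ α → δ ≢ β → Misses G c v δ → Misses G swapped v δ
  swapped-misses {v} ¬α ¬β m u e q =
    m u e (swapped-edge-cancel e (trans q (sym (swapIf-fix (does (S? v)) ¬α ¬β))))

  swapped-outside : ∀ {v} → ¬ S v → ∀ u → swapped v u ≡ c v u
  swapped-outside {v} ∉S u rewrite dec-false (S? v) ∉S = refl

SamePair : ∀ {n} → Fin n → Fin n → Fin n → Fin n → Set
SamePair u v a b = (a ≡ u × b ≡ v) ⊎ (a ≡ v × b ≡ u)

samePair? : ∀ {n} (u v a b : Fin n) → Dec (SamePair u v a b)
samePair? u v a b = ((a ≟ u) ×-dec (b ≟ v)) ⊎-dec ((a ≟ v) ×-dec (b ≟ u))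

samePair-sym : ∀ {n} {u v a b : Fin n} → SamePair u v a b → SamePair u v b a
samePair-sym (inj₁ (p , q)) = inj₂ (q , p)
samePair-sym (inj₂ (p , q)) = inj₁ (q , p)

_⊆_+⟨_—_⟩ : ∀ {n} → Graph n → Graph n → Fin n → Fin n → Set
H' ⊆ H +⟨ u — v ⟩ = ∀ {a b} → Edge H' a b → Edge H a b ⊎ SamePair u v a b

module RecolourEdge {n k : ℕ} (H : Graph n) (c : EdgeColouring n k) (c-sym : Symmetric c)
  (c-proper : Proper H c) {u v : Fin n} (u≢v : u ≢ v) {γ : Fin k}
  (u-misses : Misses H c u γ) (v-misses : Misses H c v γ)
  where

  recoloured : EdgeColouring n k
  recoloured a b with samePair? u v a b
  ... | yes _ = γ
  ... | no _ = c a b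

  recoloured-sym : Symmetric recoloured
  recoloured-sym a b with samePair? u v a b | samePair? u v b a
  ... | yes _ | yes _ = refl
  ... | yes p | no ¬p = contradiction (samePair-sym p) ¬p
  ... | no ¬p | yes p = contradiction (samePair-sym p) ¬p
  ... | no _ | no _ = c-sym a b

  recoloured-on : ∀ {a b} → SamePair u v a b → recoloured a b ≡ γ
  recoloured-on {a} {b} p with samePair? u v a b
  ... | yes _ = refl
  ... | no ¬p = contradiction p ¬p

  recoloured-off : ∀ {a b} → ¬ SamePair u v a b → recoloured a b ≡ c a b
  recoloured-off {a} {b} ¬p with samePair? u v a b
  ... | yes p = contradiction p ¬p
  ... | no _ = refl

  recoloured-misses : ∀ {z δ} → z ≢ u → z ≢ v → Misses H c z δ → Misses H recoloured z δ
  recoloured-misses z≢u z≢v m w e q = m w e (trans (sym (recoloured-off away)) q)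
    where
    away : ¬ SamePair u v _ w
    away (inj₁ (z≡u , _)) = z≢u z≡u
    away (inj₂ (z≡v , _)) = z≢v z≡v

  private
    old-edge : ∀ {H'} → H' ⊆ H +⟨ u — v ⟩ → ∀ {a b} →
               Edge H' a b → ¬ SamePair u v a b → Edge H a b
    old-edge {H'} H'⊆ e ¬p with H'⊆ e
    ... | inj₁ e = e
    ... | inj₂ p = contradiction p ¬p

    γ-missing-at : ∀ {a b b'} → SamePair u v a b → Edge H a b' → c a b' ≢ γ
    γ-missing-at (inj₁ (refl , _)) e = u-misses _ e
    γ-missing-at (inj₂ (refl , _)) e = v-misses _ e

    other-end : ∀ {a b b'} → SamePair u v a b → SamePair u v a b' → b ≡ b'
    other-end (inj₁ (_ , refl)) (inj₁ (_ , refl)) = refl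
    other-end (inj₁ (refl , _)) (inj₂ (u≡v , _)) = contradiction u≡v u≢v
    other-end (inj₂ (refl , _)) (inj₁ (v≡u , _)) = contradiction (sym v≡u) u≢v
    other-end (inj₂ (_ , refl)) (inj₂ (_ , refl)) = refl

  recoloured-proper : ∀ {H'} → H' ⊆ H +⟨ u — v ⟩ → Proper H' recoloured
  recoloured-proper {H'} H'⊆ a {w} {w'} e e' q with samePair? u v a w | samePair? u v a w'
  ... | yes p | yes p' = other-end p p'
  ... | yes p | no ¬p' = contradiction (sym q) (γ-missing-at p (old-edge {H'} H'⊆ e' ¬p'))
  ... | no ¬p | yes p' = contradiction q (γ-missing-at p' (old-edge {H'} H'⊆ e ¬p))
  ... | no ¬p | no ¬p' = c-proper a (old-edge {H'} H'⊆ e ¬p) (old-edge {H'} H'⊆ e' ¬p') q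

-- Fans

module Fans {n k : ℕ} (H : Graph n) (x y₀ : Fin n) (H' : Graph n) (H'⊆ : H' ⊆ H +⟨ x — y₀ ⟩) where

  -- x y₀ is the edge being added, not an edge of H; hence `spoke` starts at y₁.
  record Fan (c : EdgeColouring n k) (y : ℕ → Fin n) (t : ℕ) : Set where
    field
      start       : y 0 ≡ y₀
      distinct    : ∀ {a b} → a ≤ t → b ≤ t → y a ≡ y b → a ≡ b
      spoke       : ∀ {l} → l < t → Edge H x (y (suc l))
      not-centre  : ∀ {l} → l ≤ t → y l ≢ x
      misses-next : ∀ {l} → l < t → Misses H c (y l) (c x (y (suc l)))

  fan-prefix : ∀ {c c' y t t'} → t' ≤ t → Fan c y t →
               (∀ {l} → l < t' → Misses H c' (y l) (c' x (y (suc l)))) → Fan c' y t'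
  fan-prefix t'≤t F misses = record
    { start = start
    ; distinct = λ a≤ b≤ → distinct (ℕ.≤-trans a≤ t'≤t) (ℕ.≤-trans b≤ t'≤t)
    ; spoke = λ l< → spoke (ℕ.≤-trans l< t'≤t)
    ; not-centre = λ l≤ → not-centre (ℕ.≤-trans l≤ t'≤t)
    ; misses-next = misses }
    where open Fan F

  rotate : ∀ t {c} → Symmetric c → Proper H c → ∀ {y} → Fan c y t →
           ∀ {γ} → Misses H c x γ → Misses H c (y t) γ → ProperEdgeColouring H' k
  rotate zero {c} c-sym c-proper {y} F x-misses y-misses =
    recoloured , recoloured-sym ,
    recoloured-proper {H'} (subst (λ z → H' ⊆ H +⟨ x — z ⟩) (sym start) H'⊆)
    where
    open Fan F
    open RecolourEdge H c c-sym c-proper (not-centre z≤n ∘ sym) x-misses y-misses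
  rotate (suc t) {c} c-sym c-proper {y} F {γ} x-misses y-misses =
    rotate t recoloured-sym (recoloured-proper {H} inj₁) F' x-misses-δ y-misses-δ
    where
    open Fan F
    v = y (suc t)
    x≢v : x ≢ v
    x≢v = not-centre ℕ.≤-refl ∘ sym
    open RecolourEdge H c c-sym c-proper x≢v x-misses y-misses
    δ = c x v
    earlier≢v : ∀ {l} → l ≤ t → y l ≢ v
    earlier≢v {l} l≤t eq = ℕ.<-irrefl (distinct (ℕ.m≤n⇒m≤1+n l≤t) ℕ.≤-refl eq) (s≤s l≤t)
    spoke-kept : ∀ {l} → suc l ≤ t → recoloured x (y (suc l)) ≡ c x (y (suc l))
    spoke-kept l<t = recoloured-off λ
      { (inj₁ (_ , yl≡v)) → earlier≢v l<t yl≡v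
      ; (inj₂ (x≡v , _)) → x≢v x≡v }
    F' : Fan recoloured y t
    F' = fan-prefix (ℕ.n≤1+n t) F λ l<t →
      subst (Misses H recoloured _) (sym (spoke-kept l<t))
        (recoloured-misses (not-centre (ℕ.m≤n⇒m≤1+n (ℕ.<⇒≤ l<t))) (earlier≢v (ℕ.<⇒≤ l<t))
          (misses-next (ℕ.m≤n⇒m≤1+n l<t)))
    x-misses-δ : Misses H recoloured x δ
    x-misses-δ w e q = by-cases (w ≟ v)
      where
      away : w ≢ v → ¬ SamePair x v x w
      away w≢v (inj₁ (_ , w≡v)) = w≢v w≡v
      away w≢v (inj₂ (x≡v , _)) = x≢v x≡v
      by-cases : Dec (w ≡ v) → ⊥
      by-cases (yes refl) = x-misses v (spoke ℕ.≤-refl) (trans (sym q) (recoloured-on (inj₁ (refl , refl))))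
      by-cases (no w≢v) = w≢v (c-proper x e (spoke ℕ.≤-refl) (trans (sym (recoloured-off (away w≢v))) q))
    y-misses-δ : Misses H recoloured (y t) δ
    y-misses-δ = recoloured-misses (not-centre (ℕ.n≤1+n t)) (earlier≢v ℕ.≤-refl) (misses-next ℕ.≤-refl)

  fan-bound : ∀ {c y t} → Fan c y t → t < n
  fan-bound {y = y} F =
    distinct-prefix⇒< (λ i _ → y i) λ a≤t b≤t a<b same → ℕ.<⇒≢ a<b (Fan.distinct F a≤t b≤t same)

-- Vizing's theorem

module AddEdge {n Δ : ℕ} {H : Graph n} (H-degree : DegreeAtMost H Δ) {x y₀ : Fin n} (y₀≢x : y₀ ≢ x)
  (no-xy₀ : ¬ Edge H x y₀) {H' : Graph n} (H'⊆ : H' ⊆ H +⟨ x — y₀ ⟩)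
  (c : EdgeColouring n (suc Δ)) (c-sym : Symmetric c) (c-proper : Proper H c)
  where

  open Fans {k = suc Δ} H x y₀ H' H'⊆

  free : Fin n → Fin (suc Δ)
  free v = proj₁ (misses-some-colour {G = H} {c = c} H-degree c-proper v)

  free-missing : ∀ v → Misses H c v (free v)
  free-missing v = proj₂ (misses-some-colour {G = H} {c = c} H-degree c-proper v)

  -- The next spoke is the neighbour of x along the colour missing at the current spoke; the value x
  -- when there is none is never used, since the fan is then rotated rather than extended.
  spokes : ℕ → Fin n
  spokes zero = y₀
  spokes (suc t) = [ proj₁ , const x ]′ (meets-or-misses H c x (free (spokes t)))

  spokes-suc : ∀ t → Meets H c x (free (spokes t)) →
               Edge H x (spokes (suc t)) × c x (spokes (suc t)) ≡ free (spokes t)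
  spokes-suc t meets with meets-or-misses H c x (free (spokes t))
  ... | inj₁ (_ , e , q) = e , q
  ... | inj₂ misses = contradiction (proj₂ (proj₂ meets)) (misses _ (proj₁ (proj₂ meets)))

  fan-start : Fan c spokes 0
  fan-start = record
    { start = refl
    ; distinct = λ { z≤n z≤n _ → refl }
    ; spoke = λ ()
    ; not-centre = λ { z≤n → y₀≢x }
    ; misses-next = λ () }

  fan-extend : ∀ {t} → Fan c spokes t → Meets H c x (free (spokes t)) →
               (∀ {j} → j ≤ t → spokes j ≢ spokes (suc t)) → Fan c spokes (suc t)
  fan-extend {t} F meets fresh = record
    { start = start
    ; distinct = distinct′
    ; spoke = λ l<st → [ spoke , (λ { refl → x-next }) ]′ (≤-suc-split l<st)
    ; not-centre = λ l≤st → [ not-centre , (λ { refl → next≢x }) ]′ (≤-suc-split l≤st)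
    ; misses-next = λ l<st → [ misses-next , (λ { refl → last-misses }) ]′ (≤-suc-split l<st) }
    where
    open Fan F
    x-next : Edge H x (spokes (suc t))
    x-next = proj₁ (spokes-suc t meets)
    next≢x : spokes (suc t) ≢ x
    next≢x eq = edge-irrefl H (subst (Edge H x) eq x-next)
    last-misses : Misses H c (spokes t) (c x (spokes (suc t)))
    last-misses = subst (Misses H c (spokes t)) (sym (proj₂ (spokes-suc t meets))) (free-missing (spokes t))
    ≤-suc-split : ∀ {a} → a ≤ suc t → a ≤ t ⊎ a ≡ suc t
    ≤-suc-split a≤st = Sum.map₁ ℕ.≤-pred (ℕ.m≤n⇒m<n∨m≡n a≤st)
    distinct′ : ∀ {a b} → a ≤ suc t → b ≤ suc t → spokes a ≡ spokes b → a ≡ b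
    distinct′ a≤ b≤ eq with ≤-suc-split a≤ | ≤-suc-split b≤
    ... | inj₁ a≤t | inj₁ b≤t = distinct a≤t b≤t eq
    ... | inj₁ a≤t | inj₂ refl = contradiction eq (fresh a≤t)
    ... | inj₂ refl | inj₁ b≤t = contradiction (sym eq) (fresh b≤t)
    ... | inj₂ refl | inj₂ refl = refl

  -- The fan closes up: x yⱼ₊₁ already has the colour β missing at the last spoke. The Kempe chain
  -- from x cannot end at both yⱼ and yₜ, so after the swap one of them misses α, as x does.
  module Kempe {t} (F : Fan c spokes t) {j} (j<t : j < t) (cβ : c x (spokes (suc j)) ≡ free (spokes t)) where
    open Fan F

    α = free x
    β = free (spokes t)

    α≢β : α ≢ β
    α≢β α≡β = free-missing x _ (spoke j<t) (trans cβ (sym α≡β))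

    open KempePath H c c-sym c-proper α≢β x (free-missing x)

    off-path-closed : ∀ {v u} → ¬ OnPath v → Edge H v u → c v u ≡ α ⊎ c v u ≡ β → ¬ OnPath u
    off-path-closed ¬on-v e αβ on-u =
      ¬on-v (onPath-closed on-u (edge-sym H e) (Sum.map (trans (c-sym _ _)) (trans (c-sym _ _)) αβ))

    open KempeSwap H c c-sym c-proper α β (¬_ ∘ OnPath) (¬? ∘ onPath?) off-path-closed

    at-x : ∀ w → swapped x w ≡ c x w
    at-x = swapped-outside (λ ¬on → ¬on (0 , refl))

    x-misses-α : Misses H swapped x α
    x-misses-α w e q = free-missing x w e (trans (sym (at-x w)) q)

    yj-misses-β : Misses H c (spokes j) β
    yj-misses-β = subst (Misses H c (spokes j)) cβ (misses-next j<t)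

    other-spoke-misses : ∀ {l} → l < t → l ≢ j → Misses H swapped (spokes l) (swapped x (spokes (suc l)))
    other-spoke-misses {l} l<t l≢j = subst (Misses H swapped (spokes l)) (sym (at-x _))
      (swapped-misses (free-missing x _ (spoke l<t)) ≢β (misses-next l<t))
      where
      ≢β : c x (spokes (suc l)) ≢ β
      ≢β eq = l≢j (ℕ.suc-injective
        (distinct l<t j<t (c-proper x (spoke l<t) (spoke j<t) (trans eq (sym cβ)))))

    colouring : ProperEdgeColouring H' (suc Δ)
    colouring with onPath? (spokes j)
    ... | no off =
      rotate j swapped-sym swapped-proper
        (fan-prefix (ℕ.<⇒≤ j<t) F λ l<j → other-spoke-misses (ℕ.<-trans l<j j<t) (ℕ.<⇒≢ l<j))
        x-misses-α (swapped-misses-α off yj-misses-β)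
    ... | yes on =
      rotate t swapped-sym swapped-proper (fan-prefix ℕ.≤-refl F misses)
        x-misses-α (swapped-misses-α yt-off (free-missing (spokes t)))
      where
      yt-off : ¬ OnPath (spokes t)
      yt-off on-t = ℕ.<⇒≢ j<t (distinct (ℕ.<⇒≤ j<t) ℕ.≤-refl
        (onPath-end-unique on on-t (not-centre (ℕ.<⇒≤ j<t)) (not-centre ℕ.≤-refl)
          yj-misses-β (free-missing (spokes t))))
      misses : ∀ {l} → l < t → Misses H swapped (spokes l) (swapped x (spokes (suc l)))
      misses {l} l<t with l ≟ℕ j
      ... | no l≢j = other-spoke-misses l<t l≢j
      ... | yes refl = subst (Misses H swapped (spokes l)) (sym (at-x _))
            λ w e q → misses-next l<t w e (trans (sym (swapped-outside (λ ¬on → ¬on on) w)) q)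

  grow : ∀ d {t} → d + t ≡ n → Fan c spokes t → ProperEdgeColouring H' (suc Δ)
  grow zero refl F = contradiction (fan-bound F) (ℕ.n≮n _)
  grow (suc d) {t} d+t≡n F with meets-or-misses H c x (free (spokes t))
  ... | inj₂ x-misses = rotate t c-sym c-proper F x-misses (free-missing (spokes t))
  ... | inj₁ meets with ℕ.anyUpTo? (λ j → spokes j ≟ spokes (suc t)) (suc t)
  ...   | yes (zero , _ , y₀≡) =
    contradiction (subst (Edge H x) (sym y₀≡) (proj₁ (spokes-suc t meets))) no-xy₀
  ...   | yes (suc j , s≤s j<t , eq) = Kempe.colouring F j<t (trans (cong (c x) eq) (proj₂ (spokes-suc t meets)))
  ...   | no fresh = grow d (trans (ℕ.+-suc d t) d+t≡n)
                       (fan-extend F meets λ j≤t eq → fresh (_ , s≤s j≤t , eq))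

  colouring : ProperEdgeColouring H' (suc Δ)
  colouring = grow n (ℕ.+-identityʳ n) fan-start

module _ {n : ℕ} where

  Listed : List (Fin n × Fin n) → Fin n → Fin n → Set
  Listed ps a b = Any (λ (p , q) → SamePair p q a b) ps

  listed? : ∀ ps a b → Dec (Listed ps a b)
  listed? ps a b = Any.any? (λ (p , q) → samePair? p q a b) ps

  restrict : Graph n → List (Fin n × Fin n) → Graph n
  restrict G ps = record
    { adj = λ a b → adj G a b ∧ does (listed? ps a b)
    ; sym = λ a b → cong₂ _∧_ (adj-sym G a b)
              (does-⇔ (mk⇔ (Any.map samePair-sym) (Any.map samePair-sym)) (listed? ps a b) (listed? ps b a))
    ; irrefl = λ a → cong (_∧ does (listed? ps a a)) (irrefl G a) }

  restrict-⊆ : ∀ G ps → restrict G ps ⊆ G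
  restrict-⊆ G ps {a} {b} = ∧-true (adj G a b)
    where
    ∧-true : ∀ x {y} → x ∧ y ≡ true → x ≡ true
    ∧-true true _ = refl

  restrict-∷ : ∀ G p q ps → restrict G ((p , q) ∷ ps) ⊆ restrict G ps +⟨ p — q ⟩
  restrict-∷ G p q ps {a} {b} = split (adj G a b) (samePair? p q a b) (does (listed? ps a b))
    where
    split : ∀ {U : Set} x (d : Dec U) y → x ∧ (does d ∨ y) ≡ true → x ∧ y ≡ true ⊎ U
    split true (yes u) y _ = inj₂ u
    split true (no _) y e = inj₁ e

  allPairs : List (Fin n × Fin n)
  allPairs = cartesianProduct (allFin n) (allFin n)

  restrict-allPairs : ∀ G → G ⊆ restrict G allPairs
  restrict-allPairs G {a} {b} e rewrite e =
    dec-true (listed? allPairs a b)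
      (Any.map (λ { refl → inj₁ (refl , refl) }) (∈-cartesianProduct⁺ (∈-allFin a) (∈-allFin b)))

  restrict-[] : ∀ G {a b} → ¬ Edge (restrict G []) a b
  restrict-[] G {a} {b} e = contradiction (trans (sym (Bool.∧-zeroʳ (adj G a b))) e) λ ()

vizing : ∀ {n Δ} (G : Graph n) → DegreeAtMost G Δ → ProperEdgeColouring G (suc Δ)
vizing {n} {Δ} G bound =
  let c , c-sym , c-proper = colour-prefix allPairs
  in c , c-sym , proper-⊆ {H = G} {G = restrict G allPairs} (restrict-allPairs G) c-proper
  where
  keep : ∀ p q ps {c : EdgeColouring n (suc Δ)} →
         (∀ {a b} → SamePair p q a b → Edge (restrict G ((p , q) ∷ ps)) a b → Edge (restrict G ps) a b) →
         Proper (restrict G ps) c → Proper (restrict G ((p , q) ∷ ps)) c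
  keep p q ps old = proper-⊆ {H = restrict G ((p , q) ∷ ps)} {G = restrict G ps}
    λ e → [ (λ e → e) , (λ pair → old pair e) ]′ (restrict-∷ G p q ps e)

  colour-prefix : ∀ ps → ProperEdgeColouring (restrict G ps) (suc Δ)
  colour-prefix [] = (λ _ _ → Fin.zero) , (λ _ _ → refl) , λ v e → contradiction e (restrict-[] G)
  colour-prefix ((p , q) ∷ ps) with colour-prefix ps | p ≟ q | adjacent? (restrict G ps) p q
  ... | c , c-sym , c-proper | yes refl | _ =
    c , c-sym , keep p p ps (λ { (inj₁ (refl , refl)) → ⊥-elim ∘ loop ; (inj₂ (refl , refl)) → ⊥-elim ∘ loop })
      c-proper
    where loop = edge-irrefl (restrict G ((p , p) ∷ ps))
  ... | c , c-sym , c-proper | no _ | yes present =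
    c , c-sym , keep p q ps
      (λ { (inj₁ (refl , refl)) _ → present ; (inj₂ (refl , refl)) _ → edge-sym (restrict G ps) present })
      c-proper
  ... | c , c-sym , c-proper | no p≢q | no absent =
    AddEdge.colouring {H = restrict G ps} (degreeAtMost-⊆ {H = restrict G ps} {G = G} (restrict-⊆ G ps) bound)
      (p≢q ∘ sym) absent
      {H' = restrict G ((p , q) ∷ ps)} (restrict-∷ G p q ps) c c-sym c-proper

length-neighbours≤maxDegree : ∀ {n} (G : Graph n) v → length (neighbours G v) ≤ maxDegree G
length-neighbours≤maxDegree {n} G v =
  subst (_≤ maxDegree G) (sum-indicator≡length-filter (adj G v) (allFin n))
    (∈⇒≤-foldr-⊔ (map (degree G) (allFin n)) (∈-map⁺ (degree G) (∈-allFin v)))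

degreeAtMost-maxDegree : ∀ {n} (G : Graph n) → DegreeAtMost G (maxDegree G)
degreeAtMost-maxDegree {n} G v g edges g-injective =
  let i , j , i<j , same = Fin.pigeonhole (s≤s (length-neighbours≤maxDegree G v)) (Any.index ∘ listed)
  in Fin.<⇒≢ i<j (g-injective (SetoidMembership.index-injective (setoid (Fin n)) (listed i) (listed j) same))
  where
  listed : ∀ i → g i ∈ neighbours G v
  listed i = ∈-neighbours⁺ G (edges i)

-- Stars

module _ {n : ℕ} where

  canonical : Fin n → Fin n → Fin n × Fin n
  canonical u j with u Fin.<? j
  ... | yes _ = u , j
  ... | no _ = j , u

  canonical-edge : ∀ (G : Graph n) {u j} → Edge G u j → IsEdge G (canonical u j)
  canonical-edge G {u} {j} e with u Fin.<? j
  ... | yes u<j = u<j , e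
  ... | no u≮j = Fin.≤∧≢⇒< (ℕ.≮⇒≥ u≮j) (λ { refl → edge-irrefl G e }) , edge-sym G e

  canonical-injective : ∀ u {a b} → canonical u a ≡ canonical u b → a ≡ b
  canonical-injective u {a} {b} eq with u Fin.<? a | u Fin.<? b
  ... | yes _ | yes _ = cong proj₂ eq
  ... | yes _ | no _ = trans (cong proj₂ eq) (cong proj₁ eq)
  ... | no _ | yes _ = trans (cong proj₁ eq) (cong proj₂ eq)
  ... | no _ | no _ = cong proj₁ eq

  canonical-colour : ∀ {k} {c : EdgeColouring n k} → Symmetric c → ∀ u j →
                     c (proj₁ (canonical u j)) (proj₂ (canonical u j)) ≡ c u j
  canonical-colour c-sym u j with u Fin.<? j
  ... | yes _ = refl
  ... | no _ = c-sym j u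

  canonical-removed : ∀ {F} u w → canonical u w ∈ F → Removed F u w
  canonical-removed u w ∈F with u Fin.<? w
  ... | yes _ = inj₁ ∈F
  ... | no _ = inj₂ ∈F

module _ {n k : ℕ} (G : Graph n) where

  star : Fin n → EdgeSet G
  star u = edgeSet (map (canonical u) (neighbours G u))
    (AllP.map⁺ (All.map (canonical-edge G) (AllP.all-filter (adjacent? G u) (allFin n))))
    (UniqueP.map⁺ (canonical-injective u) (neighbours-unique G u))

  star-rainbow : ∀ {c : EdgeColouring n k} → Symmetric c → Proper G c → ∀ u → Rainbow c (star u)
  star-rainbow {c} c-sym c-proper u =
    subst Unique (trans (map-cong (sym ∘ canonical-colour c-sym u) (neighbours G u)) (map-∘ (neighbours G u)))
      (unique-map⁺-∈ (λ a∈ b∈ → c-proper u (∈-neighbours⁻ G a∈) (∈-neighbours⁻ G b∈))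
        (neighbours-unique G u))

  star-separates : ∀ {u v} → u ≢ v → Separates (star u) u v
  star-separates u≢v here = u≢v refl
  star-separates {u} u≢v (step {w = w} e not-removed _) =
    not-removed (canonical-removed u w (∈-map⁺ (canonical u) (∈-neighbours⁺ G e)))

  proper⇒rdAtMost : ProperEdgeColouring G k → RdAtMost G k
  proper⇒rdAtMost (c , c-sym , c-proper) =
    c , λ u v u≢v → star u , star-rainbow c-sym c-proper u , star-separates u≢v

lemma3p8 : ∀ (n : ℕ) (G : Graph n) → 2 ≤ n → Connected G →
    ∀ (L : ℕ) → IsUpperEdgeConn G L → L ≡ maxDegree G → RdAtMost G (L + 1)
lemma3p8 n G _ _ L _ refl rewrite ℕ.+-comm (maxDegree G) 1 =
  proper⇒rdAtMost G (vizing G (degreeAtMost-maxDegree G))
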